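{- Let $G$ be an ordered additive abelian group with order $\preceq$, let $a\in G$ with $0\prec a$, let $h\geq 2$ be an integer, and let $k\geq 3$ be an integer. If $A=\{0,a,2a,\dots,(k-2)a,ka\}$, then $|hA|=hk$.
   Context: An ordered additive abelian group is an additive abelian group $G$ with a total order $\preceq$ such that for all $x,y,z\in G$, $x\prec y$ implies $x+z\prec y+z$ (here $\prec$ means $\preceq$ and $\neq$). For an integer $h\geq 2$ and $A\subseteq G$, the $h$-fold sumset is $hA=\{a_1+\cdots+a_h : a_1,\dots,a_h\in A\}$ (the $a_i$ need not be distinct). For a positive integer $n$, $na$ denotes the sum of $n$ copies of $a$, and $0a=0$. -}

module Defs where

open import Level using (Level; _⊔_; suc)
open import Data.Nat using (ℕ; _≤_; _∸_)
open import Data.Fin using (Fin)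
open import Data.Product using (Σ; ∃; _×_)
open import Data.Sum using (_⊎_)
open import Relation.Nullary using (¬_)
open import Relation.Binary.PropositionalEquality using (_≡_)
open import Relation.Binary.Structures using (IsTotalOrder)
open import Algebra.Bundles using (AbelianGroup)
import Algebra.Definitions.RawMonoid as RawMonoidDefs

record OrderedAbelianGroup (c ℓ₁ ℓ₂ : Level) : Set (Level.suc (c ⊔ ℓ₁ ⊔ ℓ₂)) where
  field
    abelianGroup : AbelianGroup c ℓ₁
  open AbelianGroup abelianGroup public
  field
    _≼_          : Carrier → Carrier → Set ℓ₂
    isTotalOrder : IsTotalOrder _≈_ _≼_

  _≺_ : Carrier → Carrier → Set (ℓ₁ ⊔ ℓ₂)
  x ≺ y = (x ≼ y) × ¬ (x ≈ y)

  field
    ≺-translate : ∀ x y z → x ≺ y → (x ∙ z) ≺ (y ∙ z)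

  open RawMonoidDefs rawMonoid public using (sum) renaming (_×_ to _·_)

module _ {c ℓ₁ ℓ₂} (G : OrderedAbelianGroup c ℓ₁ ℓ₂) where
  open OrderedAbelianGroup G

  SumSet : ∀ {p} → ℕ → (Carrier → Set p) → Carrier → Set (c ⊔ ℓ₁ ⊔ p)
  SumSet h A x = Σ (Fin h → Carrier) λ v → (∀ i → A (v i)) × (x ≈ sum v)

  HasCard : ∀ {p} → (Carrier → Set p) → ℕ → Set (c ⊔ ℓ₁ ⊔ p)
  HasCard P n =
    Σ (Fin n → Carrier) λ e →
      (∀ j → P (e j)) ×
      (∀ i j → e i ≈ e j → i ≡ j) ×
      (∀ x → P x → ∃ λ j → x ≈ e j)

{-# OPTIONS --safe #-}
-- Since 0 ≺ a, the map n ↦ n · a is strictly increasing, hence injective,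
-- and it carries sums of naturals to sums in G.  So A = {d · a : d ∈ D} for
-- D = {0, …, k − 2} ∪ {k}, and hA is the injective image of the integer
-- sumset hD.  A sum of h elements of D is hk if every summand is k and at
-- most hk − 2 otherwise, and every n ≤ hk − 2 is such a sum (k ≥ 3 is needed
-- to write k − 1 = (k − 2) + 1).  Thus hD = {0, …, hk − 2} ∪ {hk}, which has
-- hk elements.
module Submission where

open import Defs
open import Level using (_⊔_; 0ℓ)
open import Data.Nat using (ℕ; zero; suc; _+_; _*_; _∸_; _≤_; _<_; z≤n; s≤s; s≤s⁻¹; +-0-rawMonoid)
open import Data.Nat.Properties
open import Data.Fin.Base using (Fin; toℕ; fromℕ<)
open import Data.Fin.Properties using (toℕ-injective; toℕ<n; toℕ-fromℕ<)
open import Data.Vec.Functional using (_∷_; tail)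
open import Data.Product using (Σ; ∃; ∃₂; _×_; _,_; proj₁; proj₂)
open import Data.Sum using (_⊎_; inj₁; inj₂)
open import Data.Empty using (⊥-elim)
open import Function.Base using (_∘_)
open import Relation.Nullary using (yes; no)
open import Relation.Unary using (Pred; _⊆_; _≐_)
open import Relation.Unary.Properties using (≐-trans)
open import Relation.Binary.PropositionalEquality using (_≡_; refl; sym; trans; cong; subst)
open import Relation.Binary.Structures using (IsTotalOrder)
open import Relation.Binary.Definitions using (tri<; tri≈; tri>)
open import Algebra.Bundles using (Monoid)
open import Algebra.Definitions.RawMonoid +-0-rawMonoid using () renaming (sum to sumℕ)
import Algebra.Definitions.RawMonoid as RawMonoidDefs
import Algebra.Properties.Monoid.Mult as MonoidMult
import Algebra.Properties.Monoid.Sum as MonoidSum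
import Relation.Binary.Construct.NonStrictToStrict as NonStrictToStrict

SumSetℕ : ∀ {p} → ℕ → Pred ℕ p → Pred ℕ p
SumSetℕ h P n = Σ (Fin h → ℕ) λ ds → (∀ i → P (ds i)) × sumℕ ds ≡ n

HasCardℕ : ∀ {p} → Pred ℕ p → ℕ → Set p
HasCardℕ P n =
  Σ (Fin n → ℕ) λ e →
    (∀ j → P (e j)) ×
    (∀ i j → e i ≡ e j → i ≡ j) ×
    (∀ m → P m → ∃ λ j → m ≡ e j)

-- {0, 1, …, N − 2} ∪ {N}; for N < 2 the truncated subtraction makes it {0, N}.
Gap : ℕ → Pred ℕ 0ℓ
Gap N n = n ≤ N ∸ 2 ⊎ n ≡ N

Gap⇒≤ : ∀ {N n} → Gap N n → n ≤ N
Gap⇒≤ (inj₁ n≤N∸2) = ≤-trans n≤N∸2 (m∸n≤m _ 2)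
Gap⇒≤ (inj₂ refl)  = ≤-refl

HasCardℕ-Gap : ∀ {N} → 2 ≤ N → HasCardℕ (Gap N) N
HasCardℕ-Gap {suc (suc M)} (s≤s (s≤s z≤n)) = enum , enum-Gap , enum-injective , enum-surjective
  where
  enum : Fin (suc (suc M)) → ℕ
  enum Fin.zero    = suc (suc M)
  enum (Fin.suc j) = toℕ j

  enum-Gap : ∀ j → Gap (suc (suc M)) (enum j)
  enum-Gap Fin.zero    = inj₂ refl
  enum-Gap (Fin.suc j) = inj₁ (s≤s⁻¹ (toℕ<n j))

  enum-injective : ∀ i j → enum i ≡ enum j → i ≡ j
  enum-injective Fin.zero    Fin.zero    _  = refl
  enum-injective Fin.zero    (Fin.suc j) eq = ⊥-elim (<-irrefl (sym eq) (m<n⇒m<1+n (toℕ<n j)))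
  enum-injective (Fin.suc i) Fin.zero    eq = ⊥-elim (<-irrefl eq (m<n⇒m<1+n (toℕ<n i)))
  enum-injective (Fin.suc i) (Fin.suc j) eq = cong Fin.suc (toℕ-injective eq)

  enum-surjective : ∀ m → Gap (suc (suc M)) m → ∃ λ j → m ≡ enum j
  enum-surjective m (inj₁ m≤M) = Fin.suc (fromℕ< (s≤s m≤M)) , sym (toℕ-fromℕ< (s≤s m≤M))
  enum-surjective m (inj₂ refl) = Fin.zero , refl

Gap-+ : ∀ {k h d s} → 2 ≤ k → Gap k d → Gap (h * k) s → Gap (suc h * k) (d + s)
Gap-+ {k} {h} {d} {s} 2≤k (inj₁ d≤k∸2) s∈ = inj₁ (begin
  d + s           ≤⟨ +-mono-≤ d≤k∸2 (Gap⇒≤ s∈) ⟩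
  k ∸ 2 + h * k   ≡⟨ +-∸-comm (h * k) 2≤k ⟨
  k + h * k ∸ 2   ∎)
  where open ≤-Reasoning
Gap-+ _ (inj₂ refl) (inj₂ refl) = inj₂ refl
Gap-+ {h = zero} _ (inj₂ refl) (inj₁ s≤0) = inj₂ (cong (_ +_) (n≤0⇒n≡0 s≤0))
Gap-+ {k} {suc h} {s = s} 2≤k (inj₂ refl) (inj₁ s≤H∸2) = inj₁ (begin
  k + s                 ≤⟨ +-monoʳ-≤ k s≤H∸2 ⟩
  k + (suc h * k ∸ 2)   ≡⟨ +-∸-assoc k (≤-trans 2≤k (m≤m+n k (h * k))) ⟨
  k + suc h * k ∸ 2     ∎)
  where open ≤-Reasoning

SumSetℕ-Gap⊆Gap : ∀ {k} h → 2 ≤ k → SumSetℕ h (Gap k) ⊆ Gap (h * k)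
SumSetℕ-Gap⊆Gap zero    _   (_ , _ , refl) = inj₂ refl
SumSetℕ-Gap⊆Gap (suc h) 2≤k (ds , ds∈ , refl) =
  Gap-+ {h = h} 2≤k (ds∈ Fin.zero) (SumSetℕ-Gap⊆Gap h 2≤k (tail ds , ds∈ ∘ Fin.suc , refl))

Gap-split : ∀ {k} h {n} → 3 ≤ k → Gap (suc h * k) n →
            ∃₂ λ d s → Gap k d × Gap (h * k) s × d + s ≡ n
Gap-split {k} zero {n} _ n∈ =
  n , 0 , subst (λ N → Gap N n) (*-identityˡ k) n∈ , inj₂ refl , +-identityʳ n
Gap-split {k} (suc h) _ (inj₂ refl) = k , suc h * k , inj₂ refl , inj₂ refl , refl
Gap-split {k@(suc (suc (suc m)))} (suc h) {n} (s≤s (s≤s (s≤s z≤n))) (inj₁ n≤) with k ≤? n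
... | yes k≤n = k , n ∸ k , inj₂ refl , inj₁ n∸k≤H∸2 , m+[n∸m]≡n k≤n
  where
  n∸k≤H∸2 : n ∸ k ≤ suc h * k ∸ 2
  n∸k≤H∸2 = m≤n+o⇒m∸n≤o n k (≤-trans n≤ (≤-reflexive (+-∸-assoc k (s≤s (s≤s z≤n)))))
... | no k≰n with n ≤? suc m
...   | yes n≤k∸2 = n , 0 , inj₁ n≤k∸2 , inj₁ z≤n , +-identityʳ n
-- The remaining n is k − 1 = (k − 2) + 1, and k ≥ 3 puts 1 in Gap (suc h * k).
...   | no n≰k∸2 = suc m , 1 , inj₁ ≤-refl , inj₁ (s≤s z≤n) , trans (+-comm (suc m) 1) n≡k∸1
  where
  n≡k∸1 : suc (suc m) ≡ n
  n≡k∸1 = ≤-antisym (≰⇒> n≰k∸2) (s≤s⁻¹ (≰⇒> k≰n))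

Gap⊆SumSetℕ-Gap : ∀ {k} h → 3 ≤ k → Gap (h * k) ⊆ SumSetℕ h (Gap k)
Gap⊆SumSetℕ-Gap zero    _   n∈ = (λ ()) , (λ ()) , sym (n≤0⇒n≡0 (Gap⇒≤ n∈))
Gap⊆SumSetℕ-Gap (suc h) 3≤k n∈ with Gap-split h 3≤k n∈
... | d , s , d∈ , s∈ , d+s≡n with Gap⊆SumSetℕ-Gap h 3≤k s∈
...   | ds , ds∈ , ∑ds≡s = d ∷ ds , d∷ds∈ , trans (cong (d +_) ∑ds≡s) d+s≡n
  where
  d∷ds∈ : ∀ i → Gap _ ((d ∷ ds) i)
  d∷ds∈ Fin.zero    = d∈
  d∷ds∈ (Fin.suc i) = ds∈ i

SumSetℕ-Gap : ∀ {k} h → 3 ≤ k → SumSetℕ h (Gap k) ≐ Gap (h * k)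
SumSetℕ-Gap h 3≤k = SumSetℕ-Gap⊆Gap h (≤-trans (n≤1+n 2) 3≤k) , Gap⊆SumSetℕ-Gap h 3≤k

module _ {c ℓ} (M : Monoid c ℓ) where
  open Monoid M renaming (refl to ≈-refl)
  open RawMonoidDefs rawMonoid using (sum) renaming (_×_ to _·_)
  open MonoidMult M using (×-homo-+)

  sum-· : ∀ {h} (ds : Fin h → ℕ) a → sum (λ i → ds i · a) ≈ sumℕ ds · a
  sum-· {zero}  ds a = ≈-refl
  sum-· {suc h} ds a = begin
    ds Fin.zero · a ∙ sum (λ i → tail ds i · a)  ≈⟨ ∙-congˡ (sum-· (tail ds) a) ⟩
    ds Fin.zero · a ∙ sumℕ (tail ds) · a         ≈⟨ ×-homo-+ a (ds Fin.zero) (sumℕ (tail ds)) ⟨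
    sumℕ ds · a                                   ∎
    where open import Relation.Binary.Reasoning.Setoid setoid

module _ {c ℓ₁ ℓ₂} (G : OrderedAbelianGroup c ℓ₁ ℓ₂) where
  open OrderedAbelianGroup G renaming (refl to ≈-refl; sym to ≈-sym; trans to ≈-trans)
  open IsTotalOrder isTotalOrder using (isPartialOrder; ≤-respˡ-≈)
  open MonoidSum monoid using (sum-cong-≋)

  ≺-trans : ∀ {x y z} → x ≺ y → y ≺ z → x ≺ z
  ≺-trans = NonStrictToStrict.<-trans _≈_ _≼_ isPartialOrder

  ≺-respˡ-≈ : ∀ {x y z} → x ≈ y → x ≺ z → y ≺ z
  ≺-respˡ-≈ = NonStrictToStrict.<-respˡ-≈ _≈_ _≼_ ≈-trans ≤-respˡ-≈

  Multiples : ∀ {p} → Carrier → Pred ℕ p → Pred Carrier (ℓ₁ ⊔ p)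
  Multiples a P x = ∃ λ d → P d × x ≈ d · a

  module _ {a : Carrier} (0≺a : ε ≺ a) where
    x≺a∙x : ∀ x → x ≺ (a ∙ x)
    x≺a∙x x = ≺-respˡ-≈ (identityˡ x) (≺-translate ε a x 0≺a)

    ·-strictMono : ∀ {m n} → m < n → (m · a) ≺ (n · a)
    ·-strictMono {m} {suc n} m<1+n with m≤n⇒m<n∨m≡n (s≤s⁻¹ m<1+n)
    ... | inj₁ m<n  = ≺-trans (·-strictMono m<n) (x≺a∙x (n · a))
    ... | inj₂ refl = x≺a∙x (m · a)

    ·-injective : ∀ {m n} → m · a ≈ n · a → m ≡ n
    ·-injective {m} {n} ma≈na with <-cmp m n
    ... | tri< m<n _ _ = ⊥-elim (proj₂ (·-strictMono m<n) ma≈na)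
    ... | tri≈ _ m≡n _ = m≡n
    ... | tri> _ _ n<m = ⊥-elim (proj₂ (·-strictMono n<m) (≈-sym ma≈na))

    HasCard-Multiples : ∀ {p q n} {P : Pred ℕ p} {Q : Pred Carrier q} →
                        HasCardℕ P n → Q ≐ Multiples a P → HasCard G Q n
    HasCard-Multiples {Q = Q} (e , e∈P , e-injective , e-surjective) (Q⊆aP , aP⊆Q) =
      (λ j → e j · a) , (λ j → aP⊆Q (e j , e∈P j , ≈-refl)) ,
      (λ i j eq → e-injective i j (·-injective eq)) , surjective
      where
      surjective : ∀ x → Q x → ∃ λ j → x ≈ e j · a
      surjective x x∈Q with Q⊆aP x∈Q
      ... | m , m∈P , x≈ma with e-surjective m m∈P
      ...   | j , refl = j , x≈ma

  SumSet-mono : ∀ {p q} h {A : Pred Carrier p} {B : Pred Carrier q} →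
                A ⊆ B → SumSet G h A ⊆ SumSet G h B
  SumSet-mono h A⊆B (v , v∈A , x≈∑v) = v , (λ i → A⊆B {v i} (v∈A i)) , x≈∑v

  SumSet-≐ : ∀ {p q} h {A : Pred Carrier p} {B : Pred Carrier q} →
             A ≐ B → SumSet G h A ≐ SumSet G h B
  SumSet-≐ h {A} {B} (A⊆B , B⊆A) = SumSet-mono h {A} {B} A⊆B , SumSet-mono h {B} {A} B⊆A

  Multiples-≐ : ∀ {p q} a {P : Pred ℕ p} {Q : Pred ℕ q} → P ≐ Q → Multiples a P ≐ Multiples a Q
  Multiples-≐ a (P⊆Q , Q⊆P) =
    (λ (d , d∈P , x≈da) → d , P⊆Q {d} d∈P , x≈da) , (λ (d , d∈Q , x≈da) → d , Q⊆P {d} d∈Q , x≈da)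

  SumSet-Multiples : ∀ {p} h a {P : Pred ℕ p} → SumSet G h (Multiples a P) ≐ Multiples a (SumSetℕ h P)
  SumSet-Multiples h a {P} = to , from
    where
    to : SumSet G h (Multiples a P) ⊆ Multiples a (SumSetℕ h P)
    to (v , v∈ , x≈∑v) =
      sumℕ ds , (ds , proj₁ ∘ proj₂ ∘ v∈ , refl) ,
      ≈-trans x≈∑v (≈-trans (sum-cong-≋ (proj₂ ∘ proj₂ ∘ v∈)) (sum-· monoid ds a))
      where
      ds : Fin h → ℕ
      ds = proj₁ ∘ v∈
    from : Multiples a (SumSetℕ h P) ⊆ SumSet G h (Multiples a P)
    from (_ , (ds , ds∈P , refl) , x≈) =
      (λ i → ds i · a) , (λ i → ds i , ds∈P i , ≈-refl) , ≈-trans x≈ (≈-sym (sum-· monoid ds a))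

  GappedProgression : Carrier → ℕ → Pred Carrier ℓ₁
  GappedProgression a k x = (∃ λ i → (i ≤ k ∸ 2) × (x ≈ i · a)) ⊎ (x ≈ k · a)

  GappedProgression≐Multiples-Gap : ∀ a k → GappedProgression a k ≐ Multiples a (Gap k)
  GappedProgression≐Multiples-Gap a k = to , from
    where
    to : GappedProgression a k ⊆ Multiples a (Gap k)
    to (inj₁ (i , i≤k∸2 , x≈ia)) = i , inj₁ i≤k∸2 , x≈ia
    to (inj₂ x≈ka)               = k , inj₂ refl , x≈ka
    from : Multiples a (Gap k) ⊆ GappedProgression a k
    from (i , inj₁ i≤k∸2 , x≈ia) = inj₁ (i , i≤k∸2 , x≈ia)
    from (_ , inj₂ refl  , x≈ka) = inj₂ x≈ka

theorem3p7 : ∀ {c ℓ₁ ℓ₂} (G : OrderedAbelianGroup c ℓ₁ ℓ₂) →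
    let open OrderedAbelianGroup G in
    (a : Carrier) → ε ≺ a →
    (h k : ℕ) → 2 ≤ h → 3 ≤ k →
    HasCard G
      (SumSet G h (λ x → (∃ λ i → (i ≤ k ∸ 2) × (x ≈ i · a)) ⊎ (x ≈ k · a)))
      (h * k)
theorem3p7 G a 0≺a h k 2≤h 3≤k =
  HasCard-Multiples G 0≺a (HasCardℕ-Gap 2≤h*k)
    (≐-trans (SumSet-≐ G h (GappedProgression≐Multiples-Gap G a k))
    (≐-trans (SumSet-Multiples G h a)
             (Multiples-≐ G a (SumSetℕ-Gap h 3≤k))))
  where
  2≤h*k : 2 ≤ h * k
  2≤h*k = ≤-trans (s≤s (s≤s z≤n)) (*-mono-≤ 2≤h 3≤k)
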